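{- Let $t\geq 4$ be an even integer, let $k\geq 1$ be an odd integer, and let $G=D(1,t)$. Then $\mathrm{rl}_k(G)\leq \frac t2 k^2$.
   Context: For a finite set $D=\{d_1<\dots<d_m\}$ of positive integers, the distance graph $D(d_1,\dots,d_m)$ has vertex set $\mathbb{Z}$, two distinct integers $i,j$ being adjacent iff $|i-j|\in D$. For a connected graph $G$ with graph distance $d(\cdot,\cdot)$ and an integer $k\ge 1$, a radio $k$-labeling of $G$ is a map $c:V(G)\to\mathbb{Z}_{\ge 0}$ such that $|c(u)-c(v)|\geq k+1-d(u,v)$ for all distinct vertices $u,v$. Its span is $\max\{c(x)-c(y): x,y\in V(G)\}$ (a supremum for infinite graphs), and the radio $k$-labeling number $\mathrm{rl}_k(G)$ is the minimum span over all radio $k$-labelings of $G$. -}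

module Defs where

open import Data.Nat as ℕ using (ℕ; zero; suc; _+_; _*_; _≤_; _<_; ∣_-_∣)
open import Data.Integer as ℤ using (ℤ)
open import Data.List using (List; _∷_; [])
open import Data.List.Membership.Propositional using (_∈_)
open import Data.Product using (Σ; _×_; _,_; ∃)
open import Relation.Binary.PropositionalEquality using (_≡_; _≢_)
open import Relation.Nullary using (¬_)

Adj : List ℕ → ℤ → ℤ → Set
Adj D i j = (i ≢ j) × (ℤ.∣ i ℤ.- j ∣ ∈ D)

data Walk (D : List ℕ) : ℤ → ℤ → ℕ → Set where
  nil  : ∀ {u} → Walk D u u zero
  cons : ∀ {u w v n} → Adj D u w → Walk D w v n → Walk D u v (suc n)

IsDist : List ℕ → ℤ → ℤ → ℕ → Set
IsDist D u v n = Walk D u v n × (∀ m → m < n → ¬ Walk D u v m)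

-- Radio k-labeling of the distance graph: |c(u) - c(v)| ≥ k + 1 - d(u,v)
-- for all distinct u, v (written additively to avoid truncated subtraction).
IsRadioLabeling : List ℕ → ℕ → (ℤ → ℕ) → Set
IsRadioLabeling D k c =
  ∀ u v → u ≢ v → ∀ n → IsDist D u v n → suc k ≤ ∣ c u - c v ∣ + n

SpanAtMost : (ℤ → ℕ) → ℕ → Set
SpanAtMost c B = ∀ x y → c x ≤ c y + B

RadioNumberAtMost : List ℕ → ℕ → ℕ → Set
RadioNumberAtMost D k B = ∃ λ (c : ℤ → ℕ) → IsRadioLabeling D k c × SpanAtMost c B

-- Label u ↦ k·u mod P, whose span is P − 1, with P = t/2 + 1 for k = 1 and
-- P = (t/2)·k² − j for k = 2j + 1 ≥ 3.  A walk of length n from u to v gives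
-- u − v = a + b·t with |a| + |b| ≤ n, and the labels of u and v differ by
-- E = |k(u − v) − m·P| for some integer m, so it suffices that no nonzero
-- x = a + b·t has |a| + |b| + E ≤ k.  As |x| ≤ t(|a| + |b|) ≤ t(k − E), k|x| is at
-- most k²t = 2(P + j): a multiple m ≥ 2 leaves no room for E > 0, and then k ∣ 2j
-- or P ≤ 2j; m = 0 contradicts E < k ≤ k|x|; for m = 1, k|x| within E of P forces
-- |x| = tk/2 with E ≥ j, or |x| < tk/2 with E ≥ j + 1, and in both cases the
-- remaining budget |a| + |b| is too small to reach x.
module Submission where

open import Defs
open import Data.Integer as ℤ using (ℤ; +_; -[1+_]; 0ℤ)
import Data.Integer.Properties as ℤ
open import Data.Integer.DivMod using (_%ℕ_; _/ℕ_; a≡a%ℕn+[a/ℕn]*n; n%ℕd<d)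
import Data.Integer.Tactic.RingSolver as ℤ-Solver
open import Data.Nat as ℕ using (ℕ; zero; suc; _+_; _*_; _∸_; _≤_; _<_; _/_; z≤n; s≤s; NonZero; >-nonZero)
open import Data.Nat.Properties
open import Algebra.Properties.CommutativeSemigroup +-commutativeSemigroup
  using () renaming (interchange to +-interchange)
open import Data.Nat.DivMod using (m*n/n≡m)
open import Data.Nat.Divisibility using (_∣_; divides; ∣-refl; ∣⇒≤; ∣m+n∣m⇒∣n; ∣m∣n⇒∣m+n; m∣m*n)
open import Data.Nat.Tactic.RingSolver using (solve-∀)
open import Data.Empty using (⊥)
open import Data.List using (_∷_; [])
open import Data.List.Relation.Unary.Any using (here; there)
open import Data.Product using (∃; ∃₂; _×_; _,_; proj₁; proj₂)
open import Data.Sum using (inj₁; inj₂)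
open import Function using (_∘_)
open import Relation.Binary using (tri<; tri≈; tri>)
open import Relation.Binary.PropositionalEquality
open import Relation.Nullary using (¬_; Dec; yes; no; contradiction)

Combination : ℕ → ℤ → ℕ → Set
Combination t x n = ∃₂ λ a b → x ≡ b ℤ.* + t ℤ.+ a × ℤ.∣ a ∣ + ℤ.∣ b ∣ ≤ n

combination-+ : ∀ {t x y m n} → Combination t x m → Combination t y n →
                Combination t (x ℤ.+ y) (m + n)
combination-+ {t} {x} {y} {m} {n} (a , b , x≡ , ∣a∣+∣b∣≤m) (a′ , b′ , y≡ , ∣a′∣+∣b′∣≤n) =
  a ℤ.+ a′ , b ℤ.+ b′ , x+y≡ , weight
  where
  regroup : ∀ a b a′ b′ c → b ℤ.* c ℤ.+ a ℤ.+ (b′ ℤ.* c ℤ.+ a′) ≡ (b ℤ.+ b′) ℤ.* c ℤ.+ (a ℤ.+ a′)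
  regroup = ℤ-Solver.solve-∀
  x+y≡ : x ℤ.+ y ≡ (b ℤ.+ b′) ℤ.* + t ℤ.+ (a ℤ.+ a′)
  x+y≡ = begin
    x ℤ.+ y                                     ≡⟨ cong₂ ℤ._+_ x≡ y≡ ⟩
    b ℤ.* + t ℤ.+ a ℤ.+ (b′ ℤ.* + t ℤ.+ a′)     ≡⟨ regroup a b a′ b′ (+ t) ⟩
    (b ℤ.+ b′) ℤ.* + t ℤ.+ (a ℤ.+ a′)           ∎
    where open ≡-Reasoning
  weight : ℤ.∣ a ℤ.+ a′ ∣ + ℤ.∣ b ℤ.+ b′ ∣ ≤ m + n
  weight = begin
    ℤ.∣ a ℤ.+ a′ ∣ + ℤ.∣ b ℤ.+ b′ ∣               ≤⟨ +-mono-≤ (ℤ.∣i+j∣≤∣i∣+∣j∣ a a′) (ℤ.∣i+j∣≤∣i∣+∣j∣ b b′) ⟩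
    (ℤ.∣ a ∣ + ℤ.∣ a′ ∣) + (ℤ.∣ b ∣ + ℤ.∣ b′ ∣)   ≡⟨ +-interchange ℤ.∣ a ∣ ℤ.∣ a′ ∣ ℤ.∣ b ∣ ℤ.∣ b′ ∣ ⟩
    (ℤ.∣ a ∣ + ℤ.∣ b ∣) + (ℤ.∣ a′ ∣ + ℤ.∣ b′ ∣)   ≤⟨ +-mono-≤ ∣a∣+∣b∣≤m ∣a′∣+∣b′∣≤n ⟩
    m + n                                         ∎
    where open ≤-Reasoning

unit-combination : ∀ {t} d → ℤ.∣ d ∣ ≡ 1 → Combination t d 1
unit-combination d ∣d∣≡1 = d , 0ℤ , sym (ℤ.+-identityˡ d) , ≤-reflexive (trans (+-identityʳ ℤ.∣ d ∣) ∣d∣≡1)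

generator-combination : ∀ d → Combination ℤ.∣ d ∣ d 1
generator-combination (+ m)    = 0ℤ , + 1 , sym (trans (ℤ.+-identityʳ _) (ℤ.*-identityˡ (+ m))) , ≤-refl
generator-combination -[1+ m ] = 0ℤ , -[1+ 0 ] , sym (trans (ℤ.+-identityʳ _) (ℤ.-1*i≡-i (+ suc m))) , ≤-refl

edge⇒combination : ∀ {t u w} → Adj (1 ∷ t ∷ []) u w → Combination t (u ℤ.- w) 1
edge⇒combination (_ , here ∣d∣≡1)         = unit-combination _ ∣d∣≡1
edge⇒combination (_ , there (here ∣d∣≡t)) = subst (λ s → Combination s _ 1) ∣d∣≡t (generator-combination _)

walk⇒combination : ∀ {t u v n} → Walk (1 ∷ t ∷ []) u v n → Combination t (u ℤ.- v) n
walk⇒combination {u = u} nil = 0ℤ , 0ℤ , ℤ.+-inverseʳ u , z≤n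
walk⇒combination {u = u} {v} (cons {w = w} edge walk) =
  subst (λ x → Combination _ x _) (telescope u w v)
    (combination-+ (edge⇒combination edge) (walk⇒combination walk))
  where
  telescope : ∀ u w v → u ℤ.- w ℤ.+ (w ℤ.- v) ≡ u ℤ.- v
  telescope = ℤ-Solver.solve-∀

Close : ℕ → ℕ → ℕ → Set
Close e m n = m ≤ n + e × n ≤ m + e

∣∣-close : ∀ {i} j e → i ≡ j ℤ.+ e → Close ℤ.∣ e ∣ ℤ.∣ i ∣ ℤ.∣ j ∣
∣∣-close j e refl =
  ℤ.∣i+j∣≤∣i∣+∣j∣ j e ,
  subst (λ x → ℤ.∣ x ∣ ≤ ℤ.∣ j ℤ.+ e ∣ + ℤ.∣ e ∣) (cancel j e) (ℤ.∣i-j∣≤∣i∣+∣j∣ (j ℤ.+ e) e)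
  where
  cancel : ∀ j e → j ℤ.+ e ℤ.- e ≡ j
  cancel = ℤ-Solver.solve-∀

∣+m-+n∣≡∣m-n∣ : ∀ m n → ℤ.∣ + m ℤ.- + n ∣ ≡ ℕ.∣ m - n ∣
∣+m-+n∣≡∣m-n∣ m n with ≤-total m n
... | inj₁ m≤n = begin
  ℤ.∣ + m ℤ.- + n ∣  ≡⟨ cong ℤ.∣_∣ (ℤ.m-n≡m⊖n m n) ⟩
  ℤ.∣ m ℤ.⊖ n ∣      ≡⟨ ℤ.∣⊖∣-≤ m≤n ⟩
  n ℕ.∸ m            ≡⟨ m≤n⇒∣m-n∣≡n∸m m≤n ⟨
  ℕ.∣ m - n ∣        ∎
  where open ≡-Reasoning
... | inj₂ n≤m = begin
  ℤ.∣ + m ℤ.- + n ∣  ≡⟨ cong ℤ.∣_∣ (ℤ.m-n≡m⊖n m n) ⟩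
  ℤ.∣ m ℤ.⊖ n ∣      ≡⟨ ℤ.∣m⊖n∣≡∣n⊖m∣ m n ⟩
  ℤ.∣ n ℤ.⊖ m ∣      ≡⟨ ℤ.∣⊖∣-≤ n≤m ⟩
  m ℕ.∸ n            ≡⟨ m≤n⇒∣m-n∣≡n∸m n≤m ⟨
  ℕ.∣ n - m ∣        ≡⟨ ∣-∣-comm n m ⟩
  ℕ.∣ m - n ∣        ∎
  where open ≡-Reasoning

-- For labels c u = k·u mod P: u − v = a + b·t (X = |u − v|, A = |a|, B = |b|) and
-- k·(u − v) = m·P + (c u − c v) (M = |m|, E = |c u − c v|), of which only the
-- triangle inequalities between the absolute values are kept.
RadioModulus : ℕ → ℕ → ℕ → Set
RadioModulus k t P = ∀ {X A B E} M → 1 ≤ X → Close A X (B * t) → Close E (k * X) (M * P) →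
                     k < A + B + E

modularLabel : (k P : ℕ) → .{{NonZero P}} → ℤ → ℕ
modularLabel k P u = (+ k ℤ.* u) %ℕ P

modularLabel-difference : ∀ k P .{{_ : NonZero P}} u v →
  + k ℤ.* (u ℤ.- v) ≡ ((+ k ℤ.* u) /ℕ P ℤ.- (+ k ℤ.* v) /ℕ P) ℤ.* + P
                        ℤ.+ (+ modularLabel k P u ℤ.- + modularLabel k P v)
modularLabel-difference k P u v = begin
  + k ℤ.* (u ℤ.- v)                                   ≡⟨ distrib (+ k) u v ⟩
  + k ℤ.* u ℤ.- + k ℤ.* v                             ≡⟨ cong₂ ℤ._-_ (a≡a%ℕn+[a/ℕn]*n (+ k ℤ.* u) P)
                                                                     (a≡a%ℕn+[a/ℕn]*n (+ k ℤ.* v) P) ⟩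
  (+ cu ℤ.+ qu ℤ.* + P) ℤ.- (+ cv ℤ.+ qv ℤ.* + P)     ≡⟨ regroup (+ cu) qu (+ cv) qv (+ P) ⟩
  (qu ℤ.- qv) ℤ.* + P ℤ.+ (+ cu ℤ.- + cv)             ∎
  where
  open ≡-Reasoning
  cu = modularLabel k P u
  cv = modularLabel k P v
  qu = (+ k ℤ.* u) /ℕ P
  qv = (+ k ℤ.* v) /ℕ P
  distrib : ∀ c u v → c ℤ.* (u ℤ.- v) ≡ c ℤ.* u ℤ.- c ℤ.* v
  distrib = ℤ-Solver.solve-∀
  regroup : ∀ c q c′ q′ p → (c ℤ.+ q ℤ.* p) ℤ.- (c′ ℤ.+ q′ ℤ.* p) ≡ (q ℤ.- q′) ℤ.* p ℤ.+ (c ℤ.- c′)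
  regroup = ℤ-Solver.solve-∀

modularLabel-span : ∀ {k P B} .{{_ : NonZero P}} → P ≤ suc B → SpanAtMost (modularLabel k P) B
modularLabel-span {k} {P} {B} P≤1+B x y =
  ≤-trans (<⇒≤pred (≤-trans (n%ℕd<d (+ k ℤ.* x) P) P≤1+B)) (m≤n+m B (modularLabel k P y))

modularLabel-radio : ∀ {k t P} .{{_ : NonZero P}} → RadioModulus k t P →
                     IsRadioLabeling (1 ∷ t ∷ []) k (modularLabel k P)
modularLabel-radio {k} {t} {P} radio u v u≢v n (walk , _)
  with a , b , u-v≡ , weight ← walk⇒combination walk = begin-strict
    k                                 <⟨ radio ℤ.∣ m ∣ 1≤X closeˣ closeᵏˣ ⟩
    ℤ.∣ a ∣ + ℤ.∣ b ∣ + E              ≤⟨ +-monoˡ-≤ E weight ⟩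
    n + E                             ≡⟨ +-comm n E ⟩
    E + n                             ∎
  where
  open ≤-Reasoning
  E = ℕ.∣ modularLabel k P u - modularLabel k P v ∣
  1≤X : 1 ≤ ℤ.∣ u ℤ.- v ∣
  1≤X = n≢0⇒n>0 (λ ∣u-v∣≡0 → u≢v (ℤ.i-j≡0⇒i≡j u v (ℤ.∣i∣≡0⇒i≡0 ∣u-v∣≡0)))
  closeˣ : Close ℤ.∣ a ∣ ℤ.∣ u ℤ.- v ∣ (ℤ.∣ b ∣ * t)
  closeˣ = subst (Close _ _) (ℤ.∣i*j∣≡∣i∣*∣j∣ b (+ t)) (∣∣-close (b ℤ.* + t) a u-v≡)
  m = (+ k ℤ.* u) /ℕ P ℤ.- (+ k ℤ.* v) /ℕ P
  closeᵏˣ : Close E (k * ℤ.∣ u ℤ.- v ∣) (ℤ.∣ m ∣ * P)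
  closeᵏˣ = subst₂ (λ e x → Close e x (ℤ.∣ m ∣ * P))
              (∣+m-+n∣≡∣m-n∣ (modularLabel k P u) (modularLabel k P v)) (ℤ.∣i*j∣≡∣i∣*∣j∣ (+ k) (u ℤ.- v))
              (subst (Close _ _) (ℤ.∣i*j∣≡∣i∣*∣j∣ m (+ P)) (∣∣-close (m ℤ.* + P) _ (modularLabel-difference k P u v)))

Close-0⇒≡ : ∀ {m n} → Close 0 m n → m ≡ n
Close-0⇒≡ {m} {n} (m≤n , n≤m) =
  ≤-antisym (≤-trans m≤n (≤-reflexive (+-identityʳ n))) (≤-trans n≤m (≤-reflexive (+-identityʳ m)))

Close-0⇒∣ : ∀ {X M P} → Close 0 (1 * X) (M * P) → P ∣ X
Close-0⇒∣ {X} {M} close = divides M (trans (sym (*-identityˡ X)) (Close-0⇒≡ close))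

k*x+r≢k*y : ∀ {k r} x y → 0 < r → r < k → k * x + r ≢ k * y
k*x+r≢k*y {k} {suc r} x y _ r<k eq =
  <⇒≱ r<k (∣⇒≤ (∣m+n∣m⇒∣n (subst (k ∣_) (sym eq) (m∣m*n y)) (m∣m*n x)))

combination≤weight*t : ∀ A B {t} → 1 ≤ t → B * t + A ≤ (A + B) * t
combination≤weight*t A B {t} 1≤t = begin
  B * t + A      ≤⟨ +-monoʳ-≤ (B * t) (subst (_≤ A * t) (*-identityʳ A) (*-monoʳ-≤ A 1≤t)) ⟩
  B * t + A * t  ≡⟨ +-comm (B * t) (A * t) ⟩
  A * t + B * t  ≡⟨ *-distribʳ-+ t A B ⟨
  (A + B) * t    ∎
  where open ≤-Reasoning

1≤weight : ∀ {X} A B {t} → 1 ≤ X → X ≤ B * t + A → 1 ≤ A + B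
1≤weight (suc A) _       _   _  = s≤s z≤n
1≤weight zero    (suc B) _   _  = s≤s z≤n
1≤weight zero    zero    1≤X X≤ with () ← ≤-trans 1≤X X≤

-- The odd-case modulus t/2 fails for k = 1, since t ≡ 0 mod t/2.
unitModulus : ∀ {T} → 2 ≤ T → RadioModulus 1 (T * 2) (suc T)
unitModulus {T} 2≤T {X} {A} {B} {E} M 1≤X closeˣ closeᵏˣ = ≰⇒> (no-collision A B E closeˣ closeᵏˣ)
  where
  1+T≰2 : ¬ suc T ≤ 2
  1+T≰2 = <⇒≱ (s≤s 2≤T)
  no-collision : ∀ A B E → Close A X (B * (T * 2)) → Close E (1 * X) (M * suc T) → A + B + E ≤ 1 → ⊥
  no-collision 1 0 0 (X≤1 , _) close _ =
    1+T≰2 (≤-trans (∣⇒≤ (subst (suc T ∣_) (≤-antisym X≤1 1≤X) (Close-0⇒∣ {M = M} close))) (s≤s z≤n))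
  no-collision 0 1 0 closeˣ close _ = 1+T≰2 (∣⇒≤ (∣m+n∣m⇒∣n 1+T∣2T+2 1+T∣2T))
    where
    1+T∣2T : suc T ∣ T * 2
    1+T∣2T = subst (suc T ∣_) (trans (Close-0⇒≡ closeˣ) (*-identityˡ (T * 2))) (Close-0⇒∣ {M = M} close)
    1+T∣2T+2 : suc T ∣ T * 2 + 2
    1+T∣2T+2 = subst (suc T ∣_) (+-comm 2 (T * 2)) (m∣m*n 2)
  no-collision 0 0 _ (X≤0 , _) _ _ with () ← ≤-trans 1≤X X≤0
  no-collision (suc (suc _)) _ _ _ _ (s≤s ())
  no-collision 1 (suc _) _ _ _ (s≤s ())
  no-collision 1 0 (suc _) _ _ (s≤s ())
  no-collision 0 1 (suc _) _ _ (s≤s ())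
  no-collision 0 (suc (suc _)) _ _ _ (s≤s ())

combination-mono-≤ : ∀ {A B b s t} → 1 ≤ t → B ≤ b → A + B ≤ b + s → B * t + A ≤ b * t + s
combination-mono-≤ {A} {B} {b} {s} {t} 1≤t B≤b A+B≤b+s with d , refl ← m≤n⇒∃[o]m+o≡n B≤b = begin
  B * t + A               ≤⟨ +-monoʳ-≤ (B * t) A≤d+s ⟩
  B * t + (d + s)         ≤⟨ +-monoʳ-≤ (B * t) (+-monoˡ-≤ s d≤d*t) ⟩
  B * t + (d * t + s)     ≡⟨ regroup B d t s ⟩
  (B + d) * t + s         ∎
  where
  open ≤-Reasoning
  swap : ∀ B d s → B + d + s ≡ d + s + B
  swap = solve-∀
  regroup : ∀ B d t s → B * t + (d * t + s) ≡ (B + d) * t + s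
  regroup = solve-∀
  A≤d+s : A ≤ d + s
  A≤d+s = +-cancelʳ-≤ B A (d + s) (subst (A + B ≤_) (swap B d s) A+B≤b+s)
  d≤d*t : d ≤ d * t
  d≤d*t = subst (_≤ d * t) (*-identityʳ d) (*-monoʳ-≤ d 1≤t)

module _ {T j P : ℕ} (2≤T : 2 ≤ T) (1≤j : 1 ≤ j)
         (P+j≡ : P + j ≡ T * ((1 + 2 * j) * (1 + 2 * j))) where

  private
    k t : ℕ
    k = 1 + 2 * j
    t = T * 2

    2≤t : 2 ≤ t
    2≤t = ≤-trans 2≤T (m≤m*n T 2)

    1≤t : 1 ≤ t
    1≤t = ≤-trans (s≤s z≤n) 2≤t

    k≡ : k ≡ 1 + j + j
    k≡ = lemma j
      where lemma : ∀ j → 1 + 2 * j ≡ 1 + j + j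
            lemma = solve-∀

    Tk≡ : T * k ≡ j * t + T
    Tk≡ = lemma T j
      where lemma : ∀ T j → T * (1 + 2 * j) ≡ j * (T * 2) + T
            lemma = solve-∀

    k*Tk≡ : k * (T * k) ≡ P + j
    k*Tk≡ = trans (lemma k T) (sym P+j≡)
      where lemma : ∀ k T → k * (T * k) ≡ T * (k * k)
            lemma = solve-∀

    k*kt≡ : k * (k * t) ≡ P + j + (P + j)
    k*kt≡ = trans (lemma k T) (cong₂ _+_ (sym P+j≡) (sym P+j≡))
      where lemma : ∀ k T → k * (k * (T * 2)) ≡ T * (k * k) + T * (k * k)
            lemma = solve-∀

    2+2j≤kt : 2 + (j + j) ≤ k * t
    2+2j≤kt = begin
      2 + (j + j)             ≤⟨ m≤m+n (2 + (j + j)) (j + j) ⟩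
      2 + (j + j) + (j + j)   ≡⟨ lemma j ⟩
      k * 2                   ≤⟨ *-monoʳ-≤ k 2≤t ⟩
      k * t                   ∎
      where
      open ≤-Reasoning
      lemma : ∀ j → 2 + (j + j) + (j + j) ≡ (1 + 2 * j) * 2
      lemma = solve-∀

    e*kt≤2j+e⇒e≡0 : ∀ e → e * (k * t) ≤ j + j + e → e ≡ 0
    e*kt≤2j+e⇒e≡0 zero    _   = refl
    e*kt≤2j+e⇒e≡0 (suc e) ekt≤ = contradiction ekt≤ (<⇒≱ (begin-strict
      j + j + suc e          ≡⟨ +-suc (j + j) e ⟩
      suc (j + j + e)        <⟨ ≤-refl ⟩
      2 + (j + j) + e        ≤⟨ +-mono-≤ 2+2j≤kt e≤e*kt ⟩
      k * t + e * (k * t)    ∎))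
      where
      open ≤-Reasoning
      e≤e*kt : e ≤ e * (k * t)
      e≤e*kt = subst (_≤ e * (k * t)) (*-identityʳ e) (*-monoʳ-≤ e (≤-trans (s≤s z≤n) 2+2j≤kt))

    2j<P : j + j < P
    2j<P = +-cancelʳ-≤ j (suc (j + j)) P (begin
      1 + (j + j) + j             ≤⟨ m≤m+n (1 + (j + j) + j) (1 + j) ⟩
      1 + (j + j) + j + (1 + j)   ≡⟨ lemma j ⟩
      2 * k                       ≤⟨ *-monoˡ-≤ k 2≤T ⟩
      T * k             ≤⟨ *-monoʳ-≤ T (m≤m*n k k) ⟩
      T * (k * k)       ≡⟨ P+j≡ ⟨
      P + j             ∎)
      where
      open ≤-Reasoning
      lemma : ∀ j → 1 + (j + j) + j + (1 + j) ≡ 2 * (1 + 2 * j)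
      lemma = solve-∀

  module _ {X A B E : ℕ} (1≤X : 1 ≤ X) (closeˣ : Close A X (B * t)) (budget : A + B + E ≤ k) where
    private
      X≤wt : X ≤ (A + B) * t
      X≤wt = ≤-trans (proj₁ closeˣ) (combination≤weight*t A B 1≤t)

      E<k : E < k
      E<k = ≤-trans (+-monoˡ-≤ E (1≤weight A B 1≤X (proj₁ closeˣ))) budget

      kX≤kwt : k * X ≤ k * ((A + B) * t)
      kX≤kwt = *-monoʳ-≤ k X≤wt

      no-multiple-0 : ¬ Close E (k * X) (0 * P)
      no-multiple-0 (kX≤E , _) = <⇒≱ E<k (≤-trans k≤kX kX≤E)
        where
        k≤kX : k ≤ k * X
        k≤kX = subst (_≤ k * X) (*-identityʳ k) (*-monoʳ-≤ k 1≤X)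

      weight+≤k : ∀ {c} → c ≤ E → A + B + c ≤ k
      weight+≤k c≤E = ≤-trans (+-monoʳ-≤ (A + B) c≤E) budget

      above : T * k < X → ¬ Close E (k * X) P
      above Tk<X (kX≤P+E , _) = <-irrefl refl (begin-strict
        P + E              <⟨ +-monoʳ-< P E<k ⟩
        P + k              ≤⟨ m≤m+n (P + k) j ⟩
        P + k + j          ≡⟨ lemma P k j ⟩
        k + (P + j)        ≡⟨ cong (λ n → k + n) k*Tk≡ ⟨
        k + k * (T * k)    ≡⟨ *-suc k (T * k) ⟨
        k * suc (T * k)    ≤⟨ *-monoʳ-≤ k Tk<X ⟩
        k * X              ≤⟨ kX≤P+E ⟩
        P + E              ∎)
        where
        open ≤-Reasoning
        lemma : ∀ P k j → P + k + j ≡ k + (P + j)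
        lemma = solve-∀

      at : X ≡ T * k → ¬ Close E (k * X) P
      at X≡Tk (kX≤P+E , _) = split (B ≤? j)
        where
        open ≤-Reasoning
        X≡ : X ≡ j * t + T
        X≡ = trans X≡Tk Tk≡
        j≤E : j ≤ E
        j≤E = +-cancelˡ-≤ P j E (subst (_≤ P + E) (trans (cong (k *_) X≡Tk) k*Tk≡) kX≤P+E)
        w≤1+j : A + B ≤ 1 + j
        w≤1+j = +-cancelʳ-≤ j (A + B) (1 + j) (≤-trans (weight+≤k j≤E) (≤-reflexive k≡))
        split : Dec (B ≤ j) → ⊥
        split (yes B≤j) = <-irrefl refl (begin-strict
          j * t + 1   <⟨ +-monoʳ-< (j * t) 2≤T ⟩
          j * t + T   ≡⟨ X≡ ⟨
          X           ≤⟨ proj₁ closeˣ ⟩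
          B * t + A   ≤⟨ combination-mono-≤ 1≤t B≤j (subst (A + B ≤_) (+-comm 1 j) w≤1+j) ⟩
          j * t + 1   ∎)
        split (no B≰j) = <-irrefl refl (begin-strict
          j * t + T + A   ≡⟨ cong (λ n → j * t + T + n) A≡0 ⟩
          j * t + T + 0   <⟨ +-monoʳ-< (j * t + T) (≤-trans (s≤s z≤n) 2≤T) ⟩
          j * t + T + T   ≡⟨ lemma j T ⟩
          suc j * t       ≤⟨ *-monoˡ-≤ t 1+j≤B ⟩
          B * t           ≤⟨ proj₂ closeˣ ⟩
          X + A           ≡⟨ cong (_+ A) X≡ ⟩
          j * t + T + A   ∎)
          where
          1+j≤B : 1 + j ≤ B
          1+j≤B = ≰⇒> B≰j
          A≡0 : A ≡ 0
          A≡0 = n≤0⇒n≡0 (+-cancelʳ-≤ (1 + j) A 0 (≤-trans (+-monoʳ-≤ A 1+j≤B) w≤1+j))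
          lemma : ∀ j T → j * (T * 2) + T + T ≡ suc j * (T * 2)
          lemma = solve-∀

      below : X < T * k → ¬ Close E (k * X) P
      below X<Tk (_ , P≤kX+E) = <-irrefl refl (begin-strict
        k * (j * t) + k * T   ≡⟨ *-distribˡ-+ k (j * t) T ⟨
        k * (j * t + T)       ≡⟨ cong (k *_) Tk≡ ⟨
        k * (T * k)           ≡⟨ k*Tk≡ ⟩
        P + j                 ≤⟨ +-monoˡ-≤ j P≤kX+E ⟩
        k * X + E + j         ≤⟨ +-monoˡ-≤ j (+-monoˡ-≤ E (*-monoʳ-≤ k X≤jt)) ⟩
        k * (j * t) + E + j   ≡⟨ +-assoc (k * (j * t)) E j ⟩
        k * (j * t) + (E + j) <⟨ +-monoʳ-< (k * (j * t)) E+j<kT ⟩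
        k * (j * t) + k * T   ∎)
        where
        open ≤-Reasoning
        1+j≤E : 1 + j ≤ E
        1+j≤E = +-cancelˡ-≤ (k * X) (1 + j) E (+-cancelʳ-≤ j _ _ (begin
          k * X + (1 + j) + j    ≡⟨ trans (+-assoc (k * X) (1 + j) j) (cong (λ n → k * X + n) (sym k≡)) ⟩
          k * X + k              ≡⟨ +-comm (k * X) k ⟩
          k + k * X              ≡⟨ *-suc k X ⟨
          k * suc X              ≤⟨ *-monoʳ-≤ k X<Tk ⟩
          k * (T * k)            ≡⟨ k*Tk≡ ⟩
          P + j                  ≤⟨ +-monoˡ-≤ j P≤kX+E ⟩
          k * X + E + j          ∎))
        w≤j : A + B ≤ j
        w≤j = +-cancelʳ-≤ (1 + j) (A + B) j
                (≤-trans (weight+≤k 1+j≤E) (≤-reflexive (trans k≡ (+-comm (1 + j) j))))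
        X≤jt : X ≤ j * t
        X≤jt = ≤-trans X≤wt (*-monoˡ-≤ t w≤j)
        E+j<kT : E + j < k * T
        E+j<kT = begin-strict
          E + j       <⟨ +-mono-<-≤ E<k (≤-trans (m≤n+m j (1 + j)) (≤-reflexive (sym k≡))) ⟩
          k + k       ≡⟨ double k ⟩
          k * 2       ≤⟨ *-monoʳ-≤ k 2≤T ⟩
          k * T       ∎
          where
          double : ∀ n → n + n ≡ n * 2
          double = solve-∀

      no-multiple-1 : ¬ Close E (k * X) P
      no-multiple-1 close with <-cmp X (T * k)
      ... | tri< X<Tk _ _ = below X<Tk close
      ... | tri≈ _ X≡Tk _ = at X≡Tk close
      ... | tri> _ _ Tk<X = above Tk<X close

      E≡0 : ∀ M → (2 + M) * P ≤ k * X + E → E ≡ 0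
      E≡0 M MP≤kX+E = e*kt≤2j+e⇒e≡0 E (+-cancelˡ-≤ (P + P) _ _ (begin
        P + P + E * (k * t)                   ≤⟨ +-monoˡ-≤ (E * (k * t)) (+-monoʳ-≤ P (m≤m+n P (M * P))) ⟩
        (2 + M) * P + E * (k * t)             ≤⟨ +-monoˡ-≤ (E * (k * t)) MP≤kX+E ⟩
        k * X + E + E * (k * t)               ≤⟨ +-monoˡ-≤ (E * (k * t)) (+-monoˡ-≤ E kX≤kwt) ⟩
        k * ((A + B) * t) + E + E * (k * t)   ≡⟨ regroup k (A + B) E t ⟩
        k * ((A + B + E) * t) + E             ≤⟨ +-monoˡ-≤ E (*-monoʳ-≤ k (*-monoˡ-≤ t budget)) ⟩
        k * (k * t) + E                       ≡⟨ cong (_+ E) k*kt≡ ⟩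
        P + j + (P + j) + E                   ≡⟨ regroup′ P j E ⟩
        P + P + (j + j + E)                   ∎))
        where
        open ≤-Reasoning
        regroup : ∀ k w e t → k * (w * t) + e + e * (k * t) ≡ k * ((w + e) * t) + e
        regroup = solve-∀
        regroup′ : ∀ P j e → P + j + (P + j) + e ≡ P + P + (j + j + e)
        regroup′ = solve-∀

      no-multiple-2+ : ∀ M → ¬ Close E (k * X) ((2 + M) * P)
      no-multiple-2+ M close = exact M (Close-0⇒≡ (subst (λ e → Close e _ _) (E≡0 M (proj₂ close)) close))
        where
        open ≤-Reasoning
        exact : ∀ M → k * X ≢ (2 + M) * P
        exact zero kX≡2P = k*x+r≢k*y X (k * t) (≤-trans 1≤j (m≤m+n j j)) (≤-reflexive (sym k≡)) (begin-equality
          k * X + (j + j)       ≡⟨ cong (_+ (j + j)) kX≡2P ⟩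
          2 * P + (j + j)       ≡⟨ regroup P j ⟩
          P + j + (P + j)       ≡⟨ k*kt≡ ⟨
          k * (k * t)           ∎)
          where
          regroup : ∀ P j → 2 * P + (j + j) ≡ P + j + (P + j)
          regroup = solve-∀
        exact (suc M) kX≡MP = <-irrefl refl (begin-strict
          P + P + (j + j)       <⟨ +-monoʳ-< (P + P) 2j<P ⟩
          P + P + P             ≤⟨ ≤-trans (m≤m+n (P + P + P) (M * P)) (≤-reflexive (regroup P M)) ⟩
          (3 + M) * P           ≡⟨ kX≡MP ⟨
          k * X                 ≤⟨ kX≤kwt ⟩
          k * ((A + B) * t)     ≤⟨ *-monoʳ-≤ k (*-monoˡ-≤ t (m≤m+n (A + B) E)) ⟩
          k * ((A + B + E) * t) ≤⟨ *-monoʳ-≤ k (*-monoˡ-≤ t budget) ⟩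
          k * (k * t)           ≡⟨ k*kt≡ ⟩
          P + j + (P + j)       ≡⟨ +-interchange P j P j ⟩
          P + P + (j + j)       ∎)
          where
          regroup : ∀ P M → P + P + P + M * P ≡ (3 + M) * P
          regroup = solve-∀

    no-multiple : ∀ M → ¬ Close E (k * X) (M * P)
    no-multiple zero          = no-multiple-0
    no-multiple (suc zero)    = no-multiple-1 ∘ subst (Close E (k * X)) (*-identityˡ P)
    no-multiple (suc (suc M)) = no-multiple-2+ M

  oddModulus : RadioModulus k t P
  oddModulus M 1≤X closeˣ closeᵏˣ = ≰⇒> λ budget → no-multiple 1≤X closeˣ budget M closeᵏˣ

odd⇒≡1+2* : ∀ k → ¬ 2 ∣ k → ∃ λ j → k ≡ 1 + 2 * j
odd⇒≡1+2* zero          2∤k = contradiction (divides 0 refl) 2∤k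
odd⇒≡1+2* (suc zero)    _   = 0 , refl
odd⇒≡1+2* (suc (suc k)) 2∤k with j , refl ← odd⇒≡1+2* k (2∤k ∘ ∣m∣n⇒∣m+n ∣-refl) = suc j , lemma j
  where
  lemma : ∀ j → 2 + (1 + 2 * j) ≡ 1 + 2 * (1 + j)
  lemma = solve-∀

radioNumberAtMost-odd : ∀ T j → 2 ≤ T →
  RadioNumberAtMost (1 ∷ T * 2 ∷ []) (1 + 2 * j) (T * ((1 + 2 * j) * (1 + 2 * j)))
radioNumberAtMost-odd T zero 2≤T =
  modularLabel 1 (suc T) , modularLabel-radio (unitModulus 2≤T) ,
  modularLabel-span {k = 1} (s≤s (≤-reflexive (sym (*-identityʳ T))))
radioNumberAtMost-odd T j@(suc _) 2≤T =
  modularLabel k P {{P≢0}} ,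
  modularLabel-radio {{P≢0}} (oddModulus {P = P} 2≤T (s≤s z≤n) (m∸n+n≡m (<⇒≤ j<Tkk))) ,
  modularLabel-span {k = k} {{P≢0}} (≤-trans (m∸n≤m (T * (k * k)) j) (n≤1+n _))
  where
  k = 1 + 2 * j
  P = T * (k * k) ∸ j
  j<Tkk : j < T * (k * k)
  j<Tkk = begin-strict
    j            <⟨ s≤s (m≤m+n j (j + 0)) ⟩
    k            ≤⟨ m≤m*n k k ⟩
    k * k        ≤⟨ m≤n*m (k * k) T {{>-nonZero (≤-trans (s≤s z≤n) 2≤T)}} ⟩
    T * (k * k)  ∎
    where open ≤-Reasoning
  P≢0 : NonZero P
  P≢0 = >-nonZero (m<n⇒0<n∸m j<Tkk)

theorem5 : (t k : ℕ) → 4 ≤ t → 2 ∣ t → 1 ≤ k → ¬ (2 ∣ k) →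
    RadioNumberAtMost (1 ∷ t ∷ []) k ((t / 2) * (k * k))
-- The hypothesis 1 ≤ k is implied by oddness.
theorem5 .(T * 2) k 4≤t (divides T refl) _ 2∤k with j , refl ← odd⇒≡1+2* k 2∤k =
  subst (λ h → RadioNumberAtMost (1 ∷ T * 2 ∷ []) k (h * (k * k))) (sym (m*n/n≡m T 2))
    (radioNumberAtMost-odd T j (*-cancelʳ-≤ 2 T 2 4≤t))
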